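{- $m_4(5)\geq 6$.
   Context: For $0\leq p<k$, $m_p(k)$ is the maximum, over all $k$-uniform intersecting families $\mathcal{G}$ (on an arbitrarily large ground set $[N]$) with covering number $\tau(\mathcal{G})=k$, of $\min\{|\{G\in\mathcal{G}:G\cap S=\emptyset\}|: S\subset[N],\ |S|=p\}$. Intersecting means any two members intersect; $\tau(\mathcal{G})$ is the minimum size of a set meeting every member. -}

module Defs where

open import Data.Nat using (ℕ; _≤_)
open import Data.Product using (Σ; _×_; _,_)
open import Data.List using (List; length; filter)
open import Data.List.Relation.Unary.All using (All)
open import Data.List.Relation.Unary.Unique.Propositional using (Unique)
open import Data.List.Membership.Propositional using (_∈_)
open import Data.Fin.Subset using (Subset; _∩_; ∣_∣; Nonempty)
open import Data.Fin.Subset.Properties using (nonempty?)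
open import Relation.Nullary.Decidable using (¬?)
open import Relation.Binary.PropositionalEquality using (_≡_)

Family : ℕ → Set
Family N = List (Subset N)

IsFamily : ∀ {N} → Family N → Set
IsFamily F = Unique F

Uniform : ∀ {N} → ℕ → Family N → Set
Uniform k F = All (λ G → ∣ G ∣ ≡ k) F

Intersecting : ∀ {N} → Family N → Set
Intersecting F = ∀ {G H} → G ∈ F → H ∈ F → Nonempty (G ∩ H)

IsCover : ∀ {N} → Family N → Subset N → Set
IsCover F T = All (λ G → Nonempty (G ∩ T)) F

CoveringNumber : ∀ {N} → Family N → ℕ → Set
CoveringNumber {N} F t =
  (Σ (Subset N) λ T → IsCover F T × ∣ T ∣ ≡ t)
  × (∀ (T : Subset N) → IsCover F T → t ≤ ∣ T ∣)

avoiding : ∀ {N} → Family N → Subset N → ℕ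
avoiding F S = length (filter (λ G → ¬? (nonempty? (G ∩ S))) F)

-- The family F witnesses m_p(k) ≥ m : F is a k-uniform intersecting family
-- with τ(F) = k such that every p-set S avoids at least m members of F.
Witness : (p k m : ℕ) → ∀ {N} → Family N → Set
Witness p k m {N} F =
  IsFamily F × Uniform k F × Intersecting F × CoveringNumber F k
  × (∀ (S : Subset N) → ∣ S ∣ ≡ p → m ≤ avoiding F S)

{-# OPTIONS --safe #-}

-- The witness is a ℤ₉-invariant family of 36 five-sets on 18 points, and an exhaustive
-- check shows that every 4-set misses at least 6 of its members. Hence no set of size at
-- most 4 is a cover, while every member of an intersecting family is one, so τ = 5.
module Submission where

open import Defs
open import Data.Nat using (ℕ)
open import Data.Product using (Σ)

open import Data.Nat using (zero; suc; _+_; _%_; _≡ᵇ_; _≤_; _<_; _≤?_; _<?_; _≟_; z≤n; s≤s)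
open import Data.Nat.Properties using (suc-injective; ≤-trans; ≤-antisym; ≰⇒>; ≮⇒≥; m≤m+n)
import Data.Bool as Bool
open import Data.Bool.ListAction using (any)
open import Data.Product using (∃; _×_; _,_)
open import Data.List using (List; []; _∷_; [_]; map; _++_; concatMap; upTo; length)
open import Data.List.Membership.Propositional using (_∈_)
open import Data.List.Membership.Propositional.Properties using (∈-map⁺; ∈-++⁺ˡ; ∈-++⁺ʳ)
open import Data.List.Relation.Unary.All as All using (All; all?)
open import Data.List.Relation.Unary.Any using (here)
open import Data.List.Properties using (filter-none)
open import Data.Vec.Properties using (≡-dec)
open import Data.List.Relation.Unary.Unique.DecPropositional (≡-dec {n = 18} Bool._≟_)
  using (unique?)
open import Data.Vec using (tabulate; _∷_) renaming ([] to []ᵛ; _++_ to _++ᵛ_)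
open import Data.Fin using (toℕ)
open import Data.Fin.Subset using (Subset; inside; outside; ⊤; _∩_; ∣_∣; Nonempty; _⊆_)
open import Data.Fin.Subset.Properties
  using (nonempty?; ∣⊤∣≡n; ⊆⊤; ⊆-refl; x∈p∩q⁺; x∈p∩q⁻; s⊆s; in⊆in)
open import Relation.Nullary using (¬?; yes; no; contradiction)
open import Relation.Nullary.Decidable using (from-yes)
open import Relation.Binary.PropositionalEquality using (_≡_; refl; cong; subst)

subsetsOfSize : (n k : ℕ) → List (Subset n)
subsetsOfSize zero    zero    = [ []ᵛ ]
subsetsOfSize zero    (suc k) = []
subsetsOfSize (suc n) zero    = map (outside ∷_) (subsetsOfSize n zero)
subsetsOfSize (suc n) (suc k) =
  map (outside ∷_) (subsetsOfSize n (suc k)) ++ map (inside ∷_) (subsetsOfSize n k)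

∈-subsetsOfSize : ∀ {n k} (S : Subset n) → ∣ S ∣ ≡ k → S ∈ subsetsOfSize n k
∈-subsetsOfSize {k = zero}  []ᵛ          refl = here refl
∈-subsetsOfSize {k = zero}  (outside ∷ S) ∣S∣≡0 = ∈-map⁺ (outside ∷_) (∈-subsetsOfSize S ∣S∣≡0)
∈-subsetsOfSize {k = suc k} (outside ∷ S) ∣S∣≡k =
  ∈-++⁺ˡ (∈-map⁺ (outside ∷_) (∈-subsetsOfSize S ∣S∣≡k))
∈-subsetsOfSize {k = suc k} (inside ∷ S)  ∣S∣≡k =
  ∈-++⁺ʳ _ (∈-map⁺ (inside ∷_) (∈-subsetsOfSize S (suc-injective ∣S∣≡k)))

all-subsetsOfSize : ∀ {n k} {P : Subset n → Set} →
                    All P (subsetsOfSize n k) → ∀ S → ∣ S ∣ ≡ k → P S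
all-subsetsOfSize all S ∣S∣≡k = All.lookup all (∈-subsetsOfSize S ∣S∣≡k)

superset-of-size : ∀ {n k} (T : Subset n) → ∣ T ∣ ≤ k → k ≤ n → ∃ λ S → T ⊆ S × ∣ S ∣ ≡ k
superset-of-size []ᵛ z≤n z≤n = []ᵛ , ⊆-refl , refl
superset-of-size (inside ∷ T) (s≤s ∣T∣≤k) (s≤s k≤n) with superset-of-size T ∣T∣≤k k≤n
... | S , T⊆S , ∣S∣≡k = inside ∷ S , in⊆in T⊆S , cong suc ∣S∣≡k
superset-of-size {suc n} {k} (outside ∷ T) ∣T∣≤k k≤1+n with k ≤? n
... | yes k≤n with superset-of-size T ∣T∣≤k k≤n
...   | S , T⊆S , ∣S∣≡k = outside ∷ S , s⊆s T⊆S , ∣S∣≡k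
superset-of-size {suc n} (outside ∷ T) ∣T∣≤k k≤1+n | no k≰n
  rewrite ≤-antisym k≤1+n (≰⇒> k≰n) = ⊤ , ⊆⊤ , ∣⊤∣≡n (suc n)

nonempty-∩-⊆ : ∀ {n} {G T S : Subset n} → T ⊆ S → Nonempty (G ∩ T) → Nonempty (G ∩ S)
nonempty-∩-⊆ {G = G} {T} T⊆S (x , x∈G∩T) with x∈p∩q⁻ G T x∈G∩T
... | x∈G , x∈T = x , x∈p∩q⁺ (x∈G , T⊆S x∈T)

isCover-⊆ : ∀ {N} {F : Family N} {T S} → T ⊆ S → IsCover F T → IsCover F S
isCover-⊆ T⊆S = All.map (nonempty-∩-⊆ T⊆S)

avoiding-cover : ∀ {N} {F : Family N} {S} → IsCover F S → avoiding F S ≡ 0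
avoiding-cover {S = S} cover =
  cong length (filter-none (λ G → ¬? (nonempty? (G ∩ S))) (All.map (λ meets misses → misses meets) cover))

member-isCover : ∀ {N} {F : Family N} {G} → Intersecting F → G ∈ F → IsCover F G
member-isCover intersecting G∈F = All.tabulate λ H∈F → intersecting H∈F G∈F

-- A cover of size at most p would extend to a p-set avoiding no member.
p<∣cover∣ : ∀ {N} {F : Family N} {p} → p ≤ N →
               (∀ S → ∣ S ∣ ≡ p → 0 < avoiding F S) → ∀ T → IsCover F T → p < ∣ T ∣
p<∣cover∣ {p = p} p≤N avoids T cover with p <? ∣ T ∣
... | yes p<∣T∣ = p<∣T∣
... | no p≮∣T∣ with superset-of-size T (≮⇒≥ p≮∣T∣) p≤N
...   | S , T⊆S , ∣S∣≡p =
  contradiction (subst (0 <_) (avoiding-cover (isCover-⊆ T⊆S cover)) (avoids S ∣S∣≡p)) λ ()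

coveringNumber-avoiding : ∀ {N} {F : Family N} {p G} → p ≤ N → Intersecting F →
                          Uniform (suc p) F → G ∈ F →
                          (∀ S → ∣ S ∣ ≡ p → 0 < avoiding F S) → CoveringNumber F (suc p)
coveringNumber-avoiding p≤N intersecting uniform G∈F avoids =
  (_ , member-isCover intersecting G∈F , All.lookup uniform G∈F) , p<∣cover∣ p≤N avoids

-- The ground set is ℤ₉ × {0, 1}, with [0 .. 8] and [9 .. 17] the two copies of ℤ₉; the
-- family is the union of the ℤ₉-orbits of four base sets, ℤ₉ translating both copies at once.
translate : ℕ → List ℕ → Subset 9
translate j xs = tabulate λ i → any (λ x → toℕ i ≡ᵇ (x + j) % 9) xs

orbit : List ℕ × List ℕ → Family 18
orbit (A , B) = map (λ j → translate j A ++ᵛ translate j B) (upTo 9)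

family : Family 18
family = concatMap orbit
  ( (0 ∷ 1 ∷ 3 ∷ 6 ∷ [] , 0 ∷ [])
  ∷ (0 ∷ 1 ∷ [] , 0 ∷ 2 ∷ 5 ∷ [])
  ∷ (0 ∷ 5 ∷ [] , 1 ∷ 7 ∷ 8 ∷ [])
  ∷ (5 ∷ 7 ∷ [] , 0 ∷ 3 ∷ 4 ∷ [])
  ∷ [])

family-unique : IsFamily family
family-unique = from-yes (unique? family)

family-uniform : Uniform 5 family
family-uniform = from-yes (all? (λ G → ∣ G ∣ ≟ 5) family)

family-intersecting : Intersecting family
family-intersecting G∈F H∈F = All.lookup (All.lookup pairwise G∈F) H∈F
  where
  pairwise : All (λ G → All (λ H → Nonempty (G ∩ H)) family) family
  pairwise = from-yes (all? (λ G → all? (λ H → nonempty? (G ∩ H)) family) family)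

family-avoiding : ∀ S → ∣ S ∣ ≡ 4 → 6 ≤ avoiding family S
family-avoiding =
  all-subsetsOfSize (from-yes (all? (λ S → 6 ≤? avoiding family S) (subsetsOfSize 18 4)))

proposition5p5 : Σ ℕ λ N → Σ (Family N) λ F → Witness 4 5 6 F
proposition5p5 =
  18 , family , family-unique , family-uniform , family-intersecting ,
  coveringNumber-avoiding (m≤m+n 4 14) family-intersecting family-uniform (here refl)
    (λ S ∣S∣≡4 → ≤-trans (s≤s z≤n) (family-avoiding S ∣S∣≡4)) ,
  family-avoiding
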